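{- If a cube orientation $\mathcal{O}$ has property L, then $\mathcal{O}$ is a unique sink orientation.
   Context: Notation: $U\oplus V$ is symmetric difference; for $U\subseteq W$, the interval is $[U,W]=\{V: U\subseteq V\subseteq W\}$. A cube orientation is a directed graph $\mathcal{O}$ with vertex set $[U,W]$ for some sets $U\subseteq W$ that contains exactly one of the directed edges $(V,V\oplus\{i\})$ and $(V\oplus\{i\},V)$ for every $V\in[U,W]$ and every $i\in W\setminus U$. Its outmap is $\phi(V)=\{i\in W\setminus U: (V,V\oplus\{i\})\text{ is an edge}\}$. For $V\in[U,W]$, the L-graph of $V$ is the directed graph with vertex set $W\setminus V$ having an arc $(i,j)$ for distinct $i,j\in W\setminus V$ whenever $j\in\phi(V)\oplus\phi(V\cup\{i\})$. $\mathcal{O}$ has property L if all its L-graphs are acyclic. A face of $\mathcal{O}$ is the subgraph induced by an interval $\mathcal{I}\subseteq[U,W]$. $\mathcal{O}$ is a unique sink orientation (USO) if every face has exactly one sink (vertex with no outgoing edge in the face). -}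

module Defs where

open import Data.Nat using (ℕ)
open import Data.Bool using (_xor_)
open import Data.Fin using (Fin)
open import Data.Fin.Subset using (Subset; _∈_; _∉_; _⊆_; _∪_; _─_; ⁅_⁆)
open import Data.Vec using (zipWith)
open import Data.Product using (Σ; ∃; _×_; _,_)
open import Data.Sum using (_⊎_)
open import Relation.Nullary using (¬_; Dec)
open import Relation.Binary.PropositionalEquality using (_≡_; _≢_)

-- Finite sets are modelled as subsets of a ground set Fin n.

infixl 6 _⊕_
_⊕_ : ∀ {n} → Subset n → Subset n → Subset n
_⊕_ = zipWith _xor_

_∈[_,_] : ∀ {n} → Subset n → Subset n → Subset n → Set
V ∈[ U , W ] = U ⊆ V × V ⊆ W

record CubeOrientation (n : ℕ) : Set₁ where
  field
    U W      : Subset n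
    U⊆W      : U ⊆ W
    Edge     : Subset n → Subset n → Set
    Edge?    : ∀ X Y → Dec (Edge X Y)
    edge-ok  : ∀ {X Y} → Edge X Y →
               X ∈[ U , W ] × Y ∈[ U , W ] × Σ (Fin n) (λ i → i ∈ W ─ U × Y ≡ X ⊕ ⁅ i ⁆)
    one-dir  : ∀ V i → V ∈[ U , W ] → i ∈ W ─ U →
               (Edge V (V ⊕ ⁅ i ⁆) ⊎ Edge (V ⊕ ⁅ i ⁆) V)
    not-both : ∀ V i → V ∈[ U , W ] → i ∈ W ─ U →
               ¬ (Edge V (V ⊕ ⁅ i ⁆) × Edge (V ⊕ ⁅ i ⁆) V)

module _ {n : ℕ} (O : CubeOrientation n) where
  open CubeOrientation O

  _∈φ_ : Fin n → Subset n → Set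
  i ∈φ V = i ∈ W ─ U × Edge V (V ⊕ ⁅ i ⁆)

  -- arcs of the L-graph of V: vertex set W ∖ V, arc (i,j) for distinct i, j
  -- with j ∈ φ(V) ⊕ φ(V ∪ {i})
  LArc : Subset n → Fin n → Fin n → Set
  LArc V i j = i ∈ W ─ V × j ∈ W ─ V × i ≢ j ×
               ((j ∈φ V × ¬ (j ∈φ (V ∪ ⁅ i ⁆))) ⊎ (¬ (j ∈φ V) × j ∈φ (V ∪ ⁅ i ⁆)))

  IsSinkIn : Subset n → Subset n → Subset n → Set
  IsSinkIn A B X = X ∈[ A , B ] × (∀ Y → Y ∈[ A , B ] → ¬ Edge X Y)

data Walk {A : Set} (R : A → A → Set) : A → A → Set where
  arc  : ∀ {x y} → R x y → Walk R x y
  _∷ʷ_ : ∀ {x y z} → R x y → Walk R y z → Walk R x z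

Acyclic : {A : Set} → (A → A → Set) → Set
Acyclic R = ∀ x → ¬ Walk R x x

PropertyL : ∀ {n} → CubeOrientation n → Set
PropertyL O = ∀ V → V ∈[ U , W ] → Acyclic (LArc O V)
  where open CubeOrientation O

IsUSO : ∀ {n} → CubeOrientation n → Set
IsUSO O = ∀ A B → U ⊆ A → A ⊆ B → B ⊆ W →
          Σ (Subset _) (λ X → IsSinkIn O A B X × (∀ Y → IsSinkIn O A B Y → Y ≡ X))
  where open CubeOrientation O

-- Write out V for (the characteristic function of) the outmap φ(V), and call vertices a ≠ b
-- distinguished if some coordinate separating a from b also separates out a from out b. If all
-- pairs of vertices of a face are distinguished, then out, restricted to the directions of the face,
-- is a bijection from the face onto all targets (a preimage is built facet by facet), so the face
-- has exactly one sink.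
--
-- Pairs are shown distinguished by induction on the face they span. For a minimal undistinguished
-- pair a, b spanning a face F, all facets of F are USOs, so in each facet every target on the
-- remaining directions has exactly one realiser. Call a target colliding in direction k if its
-- realisers in the two k-facets have the same out-bit at k. The pair (a, b) makes one target
-- colliding, and changing a target in one coordinate keeps it colliding. For the target out Z of
-- the bottom vertex Z of F this yields a vertex w ≠ Z of F with the same outmap as Z on F. Then each
-- i ∈ w ∖ Z has an L-arc to a coordinate j ∈ w ∖ Z that separates w from Z ∪ {i}, so the L-graph
-- of Z has a cycle, contradicting property L.

module Submission where

open import Defs
open import Data.Bool using (Bool; true; false; not; _xor_; _∧_; _∨_)
open import Data.Bool.Properties
  using (¬-not; not-¬; true-xor; xor-comm; xor-identityʳ; xor-same; xor-assoc;
         ∧-zeroʳ; ∧-identityʳ; ∨-identityʳ)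
  renaming (_≟_ to _≟ᵇ_)
open import Data.Empty using (⊥; ⊥-elim)
open import Data.Fin using (Fin; zero; suc; toℕ; _≟_)
open import Data.Fin.Properties using (any?; pigeonhole)
open import Data.Fin.Subset using (Subset; _∈_; _∉_; _⊆_; _⊂_; _∪_; _─_; _-_; ⁅_⁆)
open import Data.Fin.Subset.Induction using (Acc; acc; ⊂-wellFounded)
open import Data.Fin.Subset.Properties
  using (_∈?_; x∈⁅x⁆; x∈⁅y⁆⇒x≡y; x∈p∧x∉q⇒x∈p─q; x∈p∧x≢y⇒x∈p-y; x∈p⇒p-x⊂p; p─q⊆p; p⊂q⇒p⊆q; ⊆-trans)
open import Data.List using (List; []; _∷_; allFin)
open import Data.List.Membership.Propositional using () renaming (_∈_ to _∈ₗ_)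
open import Data.List.Membership.Propositional.Properties using (∈-allFin)
open import Data.List.Relation.Unary.Any using (here; there)
open import Data.Nat using (ℕ; zero; suc; _<′_; <′-base; <′-step)
open import Data.Nat.Properties using (≤⇒≤′; n<1+n)
open import Data.Product using (∃; ∃-syntax; _×_; _,_; proj₁; proj₂)
open import Data.Sum using (_⊎_; inj₁; inj₂)
open import Data.Vec using (_∷_; lookup)
open import Data.Vec.Functional using (updateAt)
open import Data.Vec.Functional.Properties using (updateAt-updates; updateAt-minimal)
open import Data.Vec.Properties
  using (lookup-zipWith; []=⇒lookup; lookup⇒[]=; tabulate∘lookup; tabulate-cong; ≡-dec)
open import Function using (_∘_; id; const; case_of_)
open import Relation.Nullary using (¬_; yes; no; does; ¬?; contradiction; _×-dec_)
open import Relation.Nullary.Decidable using (dec-true; dec-false; decidable-stable)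
open import Relation.Binary.PropositionalEquality
  using (_≡_; _≢_; refl; sym; trans; cong; subst; ≢-sym; module ≡-Reasoning)

private
  variable
    n : ℕ

-- Subsets as bit vectors

module _ {p : Subset n} {i : Fin n} where

  ∈⇒lookup≡true : i ∈ p → lookup p i ≡ true
  ∈⇒lookup≡true = []=⇒lookup

  lookup≡true⇒∈ : lookup p i ≡ true → i ∈ p
  lookup≡true⇒∈ = lookup⇒[]= i p

  ∉⇒lookup≡false : i ∉ p → lookup p i ≡ false
  ∉⇒lookup≡false i∉p = ¬-not (i∉p ∘ lookup≡true⇒∈)

lookup-ext : {p q : Subset n} → (∀ i → lookup p i ≡ lookup q i) → p ≡ q
lookup-ext {p = p} {q} eq =
  trans (sym (tabulate∘lookup p)) (trans (tabulate-cong eq) (tabulate∘lookup q))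

≢⇒lookup≢ : {p q : Subset n} → p ≢ q → ∃[ i ] lookup p i ≢ lookup q i
≢⇒lookup≢ {p = p} {q} p≢q with any? (λ i → ¬? (lookup p i ≟ᵇ lookup q i))
... | yes witness = witness
... | no none =
  contradiction (lookup-ext λ i → decidable-stable (lookup p i ≟ᵇ lookup q i) (none ∘ (i ,_))) p≢q

lookup-⊕ : ∀ (p q : Subset n) i → lookup (p ⊕ q) i ≡ lookup p i xor lookup q i
lookup-⊕ p q i = lookup-zipWith _xor_ i p q

lookup-∪ : ∀ (p q : Subset n) i → lookup (p ∪ q) i ≡ lookup p i ∨ lookup q i
lookup-∪ p q i = lookup-zipWith _∨_ i p q

lookup-─ : ∀ (p q : Subset n) i → lookup (p ─ q) i ≡ lookup p i ∧ not (lookup q i)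
lookup-─ (x ∷ p) (true ∷ q) zero = sym (∧-zeroʳ x)
lookup-─ (x ∷ p) (false ∷ q) zero = sym (∧-identityʳ x)
lookup-─ (_ ∷ p) (_ ∷ q) (suc i) = lookup-─ p q i

x∈p─q⇒x∉q : ∀ {p q : Subset n} {i} → i ∈ p ─ q → i ∉ q
x∈p─q⇒x∉q {p = p} {q} {i} i∈p─q i∈q =
  not-¬ (trans (sym (lookup-─ p q i)) (∈⇒lookup≡true i∈p─q))
        (trans (cong (λ b → lookup p i ∧ not b) (∈⇒lookup≡true i∈q)) (∧-zeroʳ (lookup p i)))

x∉p-x : ∀ (p : Subset n) i → i ∉ p - i
x∉p-x p i i∈p-i = x∈p─q⇒x∉q i∈p-i (x∈⁅x⁆ i)

─-mono : ∀ {p p′ q q′ : Subset n} → p ⊆ p′ → q′ ⊆ q → p ─ q ⊆ p′ ─ q′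
─-mono p⊆p′ q′⊆q {i} i∈p─q = x∈p∧x∉q⇒x∈p─q (p⊆p′ (p─q⊆p _ _ i∈p─q)) (x∈p─q⇒x∉q i∈p─q ∘ q′⊆q)

lookup-⁅⁆ : ∀ (i j : Fin n) → j ≢ i → lookup ⁅ i ⁆ j ≡ false
lookup-⁅⁆ i j j≢i = ∉⇒lookup≡false (j≢i ∘ x∈⁅y⁆⇒x≡y i)

lookup-flip : ∀ (p : Subset n) i → lookup (p ⊕ ⁅ i ⁆) i ≡ not (lookup p i)
lookup-flip p i = begin
  lookup (p ⊕ ⁅ i ⁆) i          ≡⟨ lookup-⊕ p ⁅ i ⁆ i ⟩
  lookup p i xor lookup ⁅ i ⁆ i  ≡⟨ cong (lookup p i xor_) (∈⇒lookup≡true (x∈⁅x⁆ i)) ⟩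
  lookup p i xor true            ≡⟨ xor-comm (lookup p i) true ⟩
  true xor lookup p i            ≡⟨ true-xor (lookup p i) ⟩
  not (lookup p i)               ∎
  where open ≡-Reasoning

lookup-flip-other : ∀ (p : Subset n) i j → j ≢ i → lookup (p ⊕ ⁅ i ⁆) j ≡ lookup p j
lookup-flip-other p i j j≢i = begin
  lookup (p ⊕ ⁅ i ⁆) j          ≡⟨ lookup-⊕ p ⁅ i ⁆ j ⟩
  lookup p j xor lookup ⁅ i ⁆ j  ≡⟨ cong (lookup p j xor_) (lookup-⁅⁆ i j j≢i) ⟩
  lookup p j xor false           ≡⟨ xor-identityʳ (lookup p j) ⟩
  lookup p j                     ∎
  where open ≡-Reasoning

lookup-flip-≢ : ∀ (p : Subset n) i → lookup p i ≢ lookup (p ⊕ ⁅ i ⁆) i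
lookup-flip-≢ p i eq = not-¬ refl (trans eq (lookup-flip p i))

∈─⇒lookup≢ : ∀ {p q : Subset n} {i} → i ∈ p ─ q → lookup p i ≢ lookup q i
∈─⇒lookup≢ {p = p} {q} {i} i∈p─q eq =
  x∈p─q⇒x∉q i∈p─q (lookup≡true⇒∈ (trans (sym eq) (∈⇒lookup≡true (p─q⊆p p q i∈p─q))))

∈─⇒lookup≡flip : ∀ {p q : Subset n} {i} → i ∈ p ─ q → lookup p i ≡ lookup (q ⊕ ⁅ i ⁆) i
∈─⇒lookup≡flip {q = q} {i} i∈p─q = trans (¬-not (∈─⇒lookup≢ i∈p─q)) (sym (lookup-flip q i))

lookup≢⇒∈─ : ∀ {p q : Subset n} {i} → q ⊆ p → lookup p i ≢ lookup q i → i ∈ p ─ q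
lookup≢⇒∈─ {p = p} {q} {i} q⊆p pi≢qi with i ∈? q
... | yes i∈q = contradiction (trans (∈⇒lookup≡true (q⊆p i∈q)) (sym (∈⇒lookup≡true i∈q))) pi≢qi
... | no i∉q = x∈p∧x∉q⇒x∈p─q (lookup≡true⇒∈ (trans (¬-not pi≢qi) (cong not (∉⇒lookup≡false i∉q)))) i∉q

⊕-cancelʳ : ∀ (p q : Subset n) → (p ⊕ q) ⊕ q ≡ p
⊕-cancelʳ p q = lookup-ext λ i → begin
  lookup ((p ⊕ q) ⊕ q) i                      ≡⟨ lookup-⊕ (p ⊕ q) q i ⟩
  lookup (p ⊕ q) i xor lookup q i             ≡⟨ cong (_xor lookup q i) (lookup-⊕ p q i) ⟩
  (lookup p i xor lookup q i) xor lookup q i  ≡⟨ xor-assoc (lookup p i) (lookup q i) (lookup q i) ⟩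
  lookup p i xor (lookup q i xor lookup q i)  ≡⟨ cong (lookup p i xor_) (xor-same (lookup q i)) ⟩
  lookup p i xor false                        ≡⟨ xor-identityʳ (lookup p i) ⟩
  lookup p i                                  ∎
  where open ≡-Reasoning

∪-⁅⁆≡⊕-⁅⁆ : ∀ {p : Subset n} {i} → i ∉ p → p ∪ ⁅ i ⁆ ≡ p ⊕ ⁅ i ⁆
∪-⁅⁆≡⊕-⁅⁆ {p = p} {i} i∉p = lookup-ext λ j →
  trans (lookup-∪ p ⁅ i ⁆ j) (trans (∨≡xor j) (sym (lookup-⊕ p ⁅ i ⁆ j)))
  where
  ∨≡xor : ∀ j → lookup p j ∨ lookup ⁅ i ⁆ j ≡ lookup p j xor lookup ⁅ i ⁆ j
  ∨≡xor j with j ≟ i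
  ... | yes refl rewrite ∉⇒lookup≡false i∉p = refl
  ... | no j≢i rewrite lookup-⁅⁆ i j j≢i = trans (∨-identityʳ _) (sym (xor-identityʳ _))

-- Faces

-- The face through c with direction set D consists of the v with DifferWithin D v c.
record DifferWithin (D v w : Subset n) : Set where
  field
    agree : ∀ i → i ∉ D → lookup v i ≡ lookup w i

open DifferWithin public

module _ {D : Subset n} where

  DifferWithin-refl : ∀ {v} → DifferWithin D v v
  DifferWithin-refl .agree _ _ = refl

  DifferWithin-sym : ∀ {v w} → DifferWithin D v w → DifferWithin D w v
  DifferWithin-sym vw .agree i i∉D = sym (agree vw i i∉D)

  DifferWithin-trans : ∀ {u v w} → DifferWithin D u v → DifferWithin D v w → DifferWithin D u w
  DifferWithin-trans uv vw .agree i i∉D = trans (agree uv i i∉D) (agree vw i i∉D)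

  DifferWithin-mono : ∀ {D′ v w} → D ⊆ D′ → DifferWithin D v w → DifferWithin D′ v w
  DifferWithin-mono D⊆D′ vw .agree i i∉D′ = agree vw i (i∉D′ ∘ D⊆D′)

  DifferWithin-∈ : ∀ {v w i} → DifferWithin D v w → lookup v i ≢ lookup w i → i ∈ D
  DifferWithin-∈ {i = i} vw vi≢wi = decidable-stable (i ∈? D) (vi≢wi ∘ agree vw i)

  DifferWithin-flip : ∀ {v i} → i ∈ D → DifferWithin D (v ⊕ ⁅ i ⁆) v
  DifferWithin-flip {v} {i} i∈D .agree j j∉D = lookup-flip-other v i j λ { refl → j∉D i∈D }

  DifferWithin-─ : ∀ {v} → DifferWithin D (v ─ D) v
  DifferWithin-─ {v} .agree i i∉D =
    trans (lookup-─ v D i) (trans (cong (λ b → lookup v i ∧ not b) (∉⇒lookup≡false i∉D)) (∧-identityʳ _))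

  DifferWithin-agree : ∀ {v w i} → DifferWithin D v w → lookup v i ≡ lookup w i → DifferWithin (D - i) v w
  DifferWithin-agree {i = i} vw vi≡wi .agree j j∉D-i with j ≟ i
  ... | yes refl = vi≡wi
  ... | no j≢i = agree vw j (j∉D-i ∘ λ j∈D → x∈p∧x≢y⇒x∈p-y j∈D j≢i)

lookup-─-∈ : ∀ (v : Subset n) {D i} → i ∈ D → lookup (v ─ D) i ≡ false
lookup-─-∈ v {D} {i} i∈D =
  trans (lookup-─ v D i) (trans (cong (λ b → lookup v i ∧ not b) (∈⇒lookup≡true i∈D)) (∧-zeroʳ _))

DifferWithin-─⇒⊆ : ∀ {D x w : Subset n} → DifferWithin D w (x ─ D) → x ─ D ⊆ w
DifferWithin-─⇒⊆ {D = D} {x} w∈ {i} i∈x─D =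
  lookup≡true⇒∈ (trans (agree w∈ i (x∈p─q⇒x∉q i∈x─D)) (∈⇒lookup≡true i∈x─D))

∈[]⇒DifferWithin : ∀ {A B X : Subset n} → A ⊆ B → X ∈[ A , B ] → DifferWithin (B ─ A) X A
∈[]⇒DifferWithin {A = A} {B} {X} A⊆B (A⊆X , X⊆B) .agree i i∉B─A with i ∈? A | i ∈? B
... | yes i∈A | _ = trans (∈⇒lookup≡true (A⊆X i∈A)) (sym (∈⇒lookup≡true i∈A))
... | no i∉A | yes i∈B = contradiction (x∈p∧x∉q⇒x∈p─q i∈B i∉A) i∉B─A
... | no i∉A | no i∉B = trans (∉⇒lookup≡false (i∉B ∘ X⊆B)) (sym (∉⇒lookup≡false i∉A))

DifferWithin⇒∈[] : ∀ {A B X : Subset n} → A ⊆ B → DifferWithin (B ─ A) X A → X ∈[ A , B ]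
DifferWithin⇒∈[] {A = A} {B} {X} A⊆B XA = A⊆X , X⊆B
  where
  A⊆X : A ⊆ X
  A⊆X {i} i∈A = lookup≡true⇒∈ (trans (agree XA i (λ i∈B─A → x∈p─q⇒x∉q i∈B─A i∈A)) (∈⇒lookup≡true i∈A))
  X⊆B : X ⊆ B
  X⊆B {i} i∈X = decidable-stable (i ∈? B) λ i∉B →
    i∉B (A⊆B (lookup≡true⇒∈ (trans (sym (agree XA i (i∉B ∘ p─q⊆p B A))) (∈⇒lookup≡true i∈X))))

-- Cycles in finite digraphs

_∷ʳʷ_ : ∀ {A : Set} {R : A → A → Set} {x y z} → Walk R x y → R y z → Walk R x z
arc r ∷ʳʷ s = r ∷ʷ arc s
(r ∷ʷ w) ∷ʳʷ s = r ∷ʷ (w ∷ʳʷ s)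

module _ {R : Fin n → Fin n → Set} {P : Fin n → Set} (next : ∀ i → P i → ∃[ j ] P j × R i j) where

  private
    step : ∃ P → ∃ P
    step (i , p) = proj₁ (next i p) , proj₁ (proj₂ (next i p))

    step-arc : ∀ s → R (proj₁ s) (proj₁ (step s))
    step-arc (i , p) = proj₂ (proj₂ (next i p))

    orbit : ∃ P → ℕ → ∃ P
    orbit s zero = s
    orbit s (suc t) = step (orbit s t)

    walk : ∀ {s a b} → a <′ b → Walk R (proj₁ (orbit s a)) (proj₁ (orbit s b))
    walk {s} {a} <′-base = arc (step-arc (orbit s a))
    walk {s} (<′-step {b} a<b) = walk a<b ∷ʳʷ step-arc (orbit s b)

  successor-closed⇒cycle : ∃ P → ∃[ i ] Walk R i i
  successor-closed⇒cycle s with pigeonhole (n<1+n n) (λ t → proj₁ (orbit s (toℕ t)))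
  ... | a , b , a<b , eq = _ , subst (Walk R _) (sym eq) (walk (≤⇒≤′ a<b))

-- Outmaps separating faces

module Outmap {n : ℕ} (φ : Subset n → Fin n → Bool) where

  -- Szabó and Welzl: an orientation is a USO iff all pairs of vertices are distinguished.
  Distinguished : Subset n → Subset n → Set
  Distinguished a b = ∃[ i ] lookup a i ≢ lookup b i × φ a i ≢ φ b i

  SeparatingOn : Subset n → Subset n → Set
  SeparatingOn D c = ∀ {a b} → DifferWithin D a c → DifferWithin D b c → a ≢ b → Distinguished a b

  Realises : Subset n → (Fin n → Bool) → Subset n → Set
  Realises D T v = ∀ i → i ∈ D → φ v i ≡ T i

  SeparatingOn-mono : ∀ {D D′ c c′} → D′ ⊆ D → DifferWithin D c′ c → SeparatingOn D c → SeparatingOn D′ c′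
  SeparatingOn-mono D′⊆D c′c sep a∈ b∈ =
    sep (DifferWithin-trans (DifferWithin-mono D′⊆D a∈) c′c)
        (DifferWithin-trans (DifferWithin-mono D′⊆D b∈) c′c)

  Realises-insert : ∀ {D T v i} → Realises (D - i) T v → φ v i ≡ T i → Realises D T v
  Realises-insert {i = i} r eq j j∈D with j ≟ i
  ... | yes refl = eq
  ... | no j≢i = r j (x∈p∧x≢y⇒x∈p-y j∈D j≢i)

  realise-unique : ∀ {D c a b} → SeparatingOn D c → DifferWithin D a c → DifferWithin D b c →
                   Realises D (φ b) a → a ≡ b
  realise-unique {a = a} {b} sep a∈ b∈ r = decidable-stable (≡-dec _≟ᵇ_ a b) λ a≢b →
    let i , ai≢bi , φai≢φbi = sep a∈ b∈ a≢b
    in φai≢φbi (r i (DifferWithin-∈ (DifferWithin-trans a∈ (DifferWithin-sym b∈)) ai≢bi))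

  facet-realisers-distinguished :
    ∀ {D c i T v₀ v₁} → DifferWithin (D - i) v₀ c → DifferWithin (D - i) v₁ (c ⊕ ⁅ i ⁆) →
    Realises (D - i) T v₀ → Realises (D - i) T v₁ → φ v₀ i ≡ φ v₁ i → ¬ Distinguished v₀ v₁
  facet-realisers-distinguished {D} {c} {i} v₀∈ v₁∈ r₀ r₁ φi (j , v₀j≢v₁j , φj≢) with j ≟ i | j ∈? D - i
  ... | yes refl | _ = φj≢ φi
  ... | no _ | yes j∈ = φj≢ (trans (r₀ j j∈) (sym (r₁ j j∈)))
  ... | no j≢i | no j∉ =
    v₀j≢v₁j (trans (agree v₀∈ j j∉) (sym (trans (agree v₁∈ j j∉) (lookup-flip-other c i j j≢i))))

  -- Realise T on both facets in direction i; the two realisers differ at i, so separation lets one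
  -- of them realise T at i as well.
  realise : ∀ {D c} → SeparatingOn D c → ∀ T → ∃[ v ] DifferWithin D v c × Realises D T v
  realise {D} = go (⊂-wellFounded D)
    where
    go : ∀ {D c} → Acc _⊂_ D → SeparatingOn D c → ∀ T → ∃[ v ] DifferWithin D v c × Realises D T v
    go {D} {c} (acc rec) sep T with any? (_∈? D)
    ... | no empty = c , DifferWithin-refl , λ i i∈D → contradiction (i , i∈D) empty
    ... | yes (i , i∈D) =
      pick (go (rec (x∈p⇒p-x⊂p i∈D)) (SeparatingOn-mono D-i⊆D DifferWithin-refl sep) T)
           (go (rec (x∈p⇒p-x⊂p i∈D)) (SeparatingOn-mono D-i⊆D (DifferWithin-flip i∈D) sep) T)
      where
      D-i⊆D = p─q⊆p D ⁅ i ⁆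
      lift₀ : ∀ {v} → DifferWithin (D - i) v c → DifferWithin D v c
      lift₀ = DifferWithin-mono D-i⊆D
      lift₁ : ∀ {v} → DifferWithin (D - i) v (c ⊕ ⁅ i ⁆) → DifferWithin D v c
      lift₁ v∈ = DifferWithin-trans (DifferWithin-mono D-i⊆D v∈) (DifferWithin-flip i∈D)
      pick : ∃[ v ] DifferWithin (D - i) v c × Realises (D - i) T v →
             ∃[ v ] DifferWithin (D - i) v (c ⊕ ⁅ i ⁆) × Realises (D - i) T v →
             ∃[ v ] DifferWithin D v c × Realises D T v
      pick (v₀ , v₀∈ , r₀) (v₁ , v₁∈ , r₁) with φ v₀ i ≟ᵇ T i | φ v₁ i ≟ᵇ T i
      ... | yes eq | _ = v₀ , lift₀ v₀∈ , Realises-insert r₀ eq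
      ... | no _ | yes eq = v₁ , lift₁ v₁∈ , Realises-insert r₁ eq
      ... | no ne₀ | no ne₁ =
        ⊥-elim (facet-realisers-distinguished v₀∈ v₁∈ r₀ r₁ (trans (¬-not ne₀) (sym (¬-not ne₁)))
                  (sep (lift₀ v₀∈) (lift₁ v₁∈) v₀≢v₁))
        where
        v₀≢v₁ : v₀ ≢ v₁
        v₀≢v₁ v₀≡v₁ = lookup-flip-≢ c i (begin
          lookup c i            ≡⟨ agree v₀∈ i (x∉p-x D i) ⟨
          lookup v₀ i           ≡⟨ cong (λ v → lookup v i) v₀≡v₁ ⟩
          lookup v₁ i           ≡⟨ agree v₁∈ i (x∉p-x D i) ⟩
          lookup (c ⊕ ⁅ i ⁆) i  ∎)
          where open ≡-Reasoning

  module Collisions {D x : Subset n} {k : Fin n} (k∈D : k ∈ D)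
                    (facets : ∀ {l c} → l ∈ D → DifferWithin D c x → SeparatingOn (D - l) c) where

    record Collision (T : Fin n → Bool) : Set where
      field
        {low high} : Subset n
        low∈       : DifferWithin D low x
        high∈      : DifferWithin D high x
        low-k      : lookup low k ≡ false
        high-k     : lookup high k ≡ true
        low-T      : Realises (D - k) T low
        high-T     : Realises (D - k) T high
        same-k     : φ low k ≡ φ high k

    differ-at-k : ∀ {b c} → lookup b k ≡ false → lookup c k ≡ true → b ≢ c
    differ-at-k bk ck refl with () ← trans (sym bk) ck

    realisers-agree : ∀ {S S′ b c l} → Realises (D - k) S b → Realises (D - k) S′ c →
                      (∀ j → j ≢ l → S j ≡ S′ j) → ∀ j → j ∈ D - k → j ≢ l → φ b j ≡ φ c j
    realisers-agree rb rc S≡S′ j j∈ j≢l = trans (rb j j∈) (trans (S≡S′ j j≢l) (sym (rc j j∈)))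

    realisers-differ : ∀ {S S′ b c j} → Realises (D - k) S b → Realises (D - k) S′ c → j ∈ D - k →
                       S′ j ≡ not (S j) → b ≢ c
    realisers-differ rb rc j∈ flipped refl = not-¬ refl (trans (sym (rb _ j∈)) (trans (rc _ j∈) flipped))

    distinguished-at-k : ∀ {b c l} → DifferWithin D b x → DifferWithin D c x → l ∈ D →
                  (∀ j → j ∈ D - k → j ≢ l → φ b j ≡ φ c j) →
                  lookup b l ≡ lookup c l → b ≢ c → lookup b k ≢ lookup c k × φ b k ≢ φ c k
    distinguished-at-k {l = l} b∈ c∈ l∈D φ≡ bl≡cl b≢c
      with facets l∈D b∈ DifferWithin-refl
                  (DifferWithin-agree (DifferWithin-trans c∈ (DifferWithin-sym b∈)) (sym bl≡cl)) b≢c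
    ... | j , bj≢cj , φj≢ with j ≟ k | j ≟ l
    ...   | yes refl | _ = bj≢cj , φj≢
    ...   | no _ | yes refl = contradiction bl≡cl bj≢cj
    ...   | no j≢k | no j≢l = contradiction (φ≡ j (x∈p∧x≢y⇒x∈p-y j∈D j≢k) j≢l) φj≢
      where j∈D = DifferWithin-∈ (DifferWithin-trans b∈ (DifferWithin-sym c∈)) bj≢cj

    realise-in-k-facet : ∀ {v} → DifferWithin D v x → ∀ T →
                         ∃[ v′ ] DifferWithin D v′ x × lookup v′ k ≡ lookup v k × Realises (D - k) T v′
    realise-in-k-facet v∈ T with realise (facets k∈D v∈) T
    ... | v′ , v′∈ , r =
      v′ , DifferWithin-trans (DifferWithin-mono (p─q⊆p D ⁅ k ⁆) v′∈) v∈ , agree v′∈ k (x∉p-x D k) , r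

    -- Let u′, w′ realise T′ in the k-facets of u, w. By distinguished-at-k, each of the pairs
    -- (u, w), (u, u′), (w, w′) differs at l; hence u agrees with w′ and u′ with w at l, and
    -- distinguished-at-k applied to these two pairs gives the new collision.
    collision-flip : ∀ {T T′ l} → Collision T → l ∈ D - k → (∀ j → j ≢ l → T j ≡ T′ j) →
                     T′ l ≡ not (T l) → Collision T′
    collision-flip {T} {T′} {l} col l∈ T≡T′ flipped
      with realise-in-k-facet (Collision.low∈ col) T′ | realise-in-k-facet (Collision.high∈ col) T′
    ... | u′ , u′∈ , u′k≡uk , u′-T | w′ , w′∈ , w′k≡wk , w′-T = record
      { low∈ = u′∈ ; high∈ = w′∈ ; low-k = u′-k ; high-k = w′-k ; low-T = u′-T ; high-T = w′-T
      ; same-k = trans (¬-not φu′k≢φwk) (trans (cong not (sym same-k)) (sym (¬-not (≢-sym φuk≢φw′k)))) }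
      where
      open Collision col renaming (low to u; high to w; low∈ to u∈; high∈ to w∈;
                                   low-k to u-k; high-k to w-k; low-T to u-T; high-T to w-T)
      l∈D = p─q⊆p D ⁅ k ⁆ l∈
      u′-k = trans u′k≡uk u-k
      w′-k = trans w′k≡wk w-k
      ul≢wl : lookup u l ≢ lookup w l
      ul≢wl eq = proj₂ (distinguished-at-k u∈ w∈ l∈D (realisers-agree u-T w-T λ _ _ → refl) eq
                                           (differ-at-k u-k w-k)) same-k
      ul≢u′l : lookup u l ≢ lookup u′ l
      ul≢u′l eq = proj₁ (distinguished-at-k u∈ u′∈ l∈D (realisers-agree u-T u′-T T≡T′) eq
                           (realisers-differ u-T u′-T l∈ flipped)) (sym u′k≡uk)
      wl≢w′l : lookup w l ≢ lookup w′ l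
      wl≢w′l eq = proj₁ (distinguished-at-k w∈ w′∈ l∈D (realisers-agree w-T w′-T T≡T′) eq
                           (realisers-differ w-T w′-T l∈ flipped)) (sym w′k≡wk)
      φuk≢φw′k : φ u k ≢ φ w′ k
      φuk≢φw′k = proj₂ (distinguished-at-k u∈ w′∈ l∈D (realisers-agree u-T w′-T T≡T′)
                          (trans (¬-not ul≢wl) (sym (¬-not (≢-sym wl≢w′l)))) (differ-at-k u-k w′-k))
      φu′k≢φwk : φ u′ k ≢ φ w k
      φu′k≢φwk = proj₂ (distinguished-at-k u′∈ w∈ l∈D (realisers-agree u′-T w-T λ j j≢l → sym (T≡T′ j j≢l))
                          (trans (¬-not (≢-sym ul≢u′l)) (sym (¬-not (≢-sym ul≢wl)))) (differ-at-k u′-k w-k))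

    collision-respect : ∀ {T T′} → Collision T → (∀ j → j ∈ D - k → T j ≡ T′ j) → Collision T′
    collision-respect col T≡T′ = record
      { low∈ = low∈ ; high∈ = high∈ ; low-k = low-k ; high-k = high-k ; same-k = same-k
      ; low-T = λ j j∈ → trans (low-T j j∈) (T≡T′ j j∈)
      ; high-T = λ j j∈ → trans (high-T j j∈) (T≡T′ j j∈) }
      where open Collision col

    collision-change-one : ∀ {T T′ l} → Collision T → (∀ j → j ≢ l → T j ≡ T′ j) → Collision T′
    collision-change-one {T} {T′} {l} col T≡T′ with T′ l ≟ᵇ T l | l ∈? D - k
    ... | no T′l≢Tl | yes l∈ = collision-flip col l∈ T≡T′ (¬-not T′l≢Tl)
    ... | yes T′l≡Tl | _ = collision-respect col λ j _ → case j ≟ l of λ where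
      (yes refl) → sym T′l≡Tl
      (no j≢l) → T≡T′ j j≢l
    ... | no _ | no l∉ = collision-respect col λ j j∈ → T≡T′ j λ { refl → l∉ j∈ }

    collision-everywhere : ∀ {T} → Collision T → ∀ T′ → Collision T′
    collision-everywhere col T′ = go (allFin n) col (λ j → inj₁ (∈-allFin j))
      where
      go : ∀ {S} (js : List (Fin n)) → Collision S → (∀ j → j ∈ₗ js ⊎ S j ≡ T′ j) → Collision T′
      go [] col S≡T′ = collision-respect col λ j _ → case S≡T′ j of λ where
        (inj₁ ())
        (inj₂ eq) → eq
      go {S} (l ∷ js) col S≡T′ =
        go js (collision-change-one col λ j j≢l → sym (updateAt-minimal j l S j≢l)) updated≡T′
        where
        updated≡T′ : ∀ j → j ∈ₗ js ⊎ updateAt S l (const (T′ l)) j ≡ T′ j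
        updated≡T′ j with j ≟ l | S≡T′ j
        ... | yes refl | _ = inj₂ (updateAt-updates j S)
        ... | no j≢l | inj₁ (here refl) = contradiction refl j≢l
        ... | no j≢l | inj₁ (there j∈js) = inj₁ j∈js
        ... | no j≢l | inj₂ eq = inj₂ (trans (updateAt-minimal j l S j≢l) eq)

    pair-collision : ∀ {b} → DifferWithin D b x → lookup x k ≢ lookup b k → Realises D (φ x) b →
                     Collision (φ x)
    pair-collision {b} b∈ xk≢bk r with lookup x k in xk
    ... | false = record
      { low∈ = DifferWithin-refl ; high∈ = b∈ ; low-k = xk ; high-k = ¬-not (≢-sym xk≢bk)
      ; low-T = λ _ _ → refl ; high-T = λ j j∈ → r j (p─q⊆p D ⁅ k ⁆ j∈) ; same-k = sym (r k k∈D) }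
    ... | true = record
      { low∈ = b∈ ; high∈ = DifferWithin-refl ; low-k = ¬-not (≢-sym xk≢bk) ; high-k = xk
      ; low-T = λ j j∈ → r j (p─q⊆p D ⁅ k ⁆ j∈) ; high-T = λ _ _ → refl ; same-k = r k k∈D }

    -- x ─ D is the bottom vertex of the face through x with directions D.
    bottom-twin : ∀ {T} → Collision T →
                  ∃[ w ] DifferWithin D w (x ─ D) × w ≢ x ─ D × Realises D (φ (x ─ D)) w
    bottom-twin col =
      high , DifferWithin-trans high∈ x∈ , ≢-sym (differ-at-k bottom-k high-k) ,
      Realises-insert high-T (trans (sym same-k) (cong (λ v → φ v k) low≡bottom))
      where
      open Collision (collision-everywhere col (φ (x ─ D)))
      x∈ : DifferWithin D x (x ─ D)
      x∈ = DifferWithin-sym DifferWithin-─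
      bottom-k : lookup (x ─ D) k ≡ false
      bottom-k = lookup-─-∈ x k∈D
      low≡bottom : low ≡ x ─ D
      low≡bottom = realise-unique (facets k∈D DifferWithin-─)
        (DifferWithin-agree (DifferWithin-trans low∈ x∈) (trans low-k (sym bottom-k))) DifferWithin-refl low-T

-- Cube orientations with property L

module _ {n : ℕ} (O : CubeOrientation n) where
  open CubeOrientation O

  -- out V is the characteristic function of the outmap φ(V); it vanishes off W ─ U.
  out : Subset n → Fin n → Bool
  out V i = does (Edge? V (V ⊕ ⁅ i ⁆))

  open Outmap out

  out≡true⇒Edge : ∀ {V i} → out V i ≡ true → Edge V (V ⊕ ⁅ i ⁆)
  out≡true⇒Edge {V} {i} eq with Edge? V (V ⊕ ⁅ i ⁆)
  ... | yes e = e
  ... | no _ with () ← eq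

  Edge⇒out≡true : ∀ {V i} → Edge V (V ⊕ ⁅ i ⁆) → out V i ≡ true
  Edge⇒out≡true = dec-true (Edge? _ _)

  out-flip : ∀ {V i} → V ∈[ U , W ] → i ∈ W ─ U → out (V ⊕ ⁅ i ⁆) i ≡ not (out V i)
  out-flip {V} {i} V∈ i∈ with one-dir V i V∈ i∈
  ... | inj₁ e = trans (dec-false (Edge? _ _) λ e′ →
                          not-both V i V∈ i∈ (e , subst (Edge _) (⊕-cancelʳ V ⁅ i ⁆) e′))
                       (cong not (sym (Edge⇒out≡true e)))
  ... | inj₂ e = trans (Edge⇒out≡true (subst (Edge _) (sym (⊕-cancelʳ V ⁅ i ⁆)) e))
                       (cong not (sym (dec-false (Edge? _ _) λ e′ → not-both V i V∈ i∈ (e′ , e))))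

  ∈φ-differ : ∀ {V V′ j} → j ∈ W ─ U → out V j ≢ out V′ j →
              (_∈φ_ O j V × ¬ _∈φ_ O j V′) ⊎ (¬ _∈φ_ O j V × _∈φ_ O j V′)
  ∈φ-differ {V} {V′} {j} j∈ out≢ with out V j in eq
  ... | true = inj₁ ((j∈ , out≡true⇒Edge eq) , λ (_ , e) → out≢ (sym (Edge⇒out≡true e)))
  ... | false = inj₂ ((λ (_ , e) → not-¬ (Edge⇒out≡true e) eq) , (j∈ , out≡true⇒Edge (¬-not (out≢ ∘ sym))))

  L-arc : ∀ {Z i j} → Z ∈[ U , W ] → i ∈ W ─ Z → j ∈ W ─ Z → i ≢ j → out Z j ≢ out (Z ⊕ ⁅ i ⁆) j →
          LArc O Z i j
  L-arc {Z} {i} {j} (U⊆Z , _) i∈ j∈ i≢j out≢ =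
    i∈ , j∈ , i≢j ,
    subst (λ V → (_∈φ_ O j Z × ¬ _∈φ_ O j V) ⊎ (¬ _∈φ_ O j Z × _∈φ_ O j V))
          (sym (∪-⁅⁆≡⊕-⁅⁆ (x∈p─q⇒x∉q i∈))) (∈φ-differ (─-mono id U⊆Z j∈) out≢)

  L-cycle : ∀ {Z w} → Z ∈[ U , W ] → w ⊆ W → Z ⊆ w → Z ≢ w →
            (∀ {i} → i ∈ w ─ Z → out Z i ≡ out w i) →
            (∀ {i} → i ∈ w ─ Z → Distinguished w (Z ⊕ ⁅ i ⁆)) →
            ∃[ i ] Walk (LArc O Z) i i
  L-cycle {Z} {w} Z∈ w⊆W Z⊆w Z≢w same-out distinguished = successor-closed⇒cycle successor start
    where
    start : ∃[ i ] i ∈ w ─ Z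
    start with ≢⇒lookup≢ Z≢w
    ... | i , Zi≢wi = i , lookup≢⇒∈─ Z⊆w (≢-sym Zi≢wi)
    successor : ∀ i → i ∈ w ─ Z → ∃[ j ] j ∈ w ─ Z × LArc O Z i j
    successor i i∈ with distinguished i∈
    ... | j , wj≢ , out≢ = j , j∈ , L-arc Z∈ (─-mono w⊆W id i∈) (─-mono w⊆W id j∈) (≢-sym j≢i)
                                          (λ eq → out≢ (trans (sym (same-out j∈)) eq))
      where
      j≢i : j ≢ i
      j≢i refl = wj≢ (∈─⇒lookup≡flip i∈)
      j∈ : j ∈ w ─ Z
      j∈ = lookup≢⇒∈─ Z⊆w λ eq → wj≢ (trans eq (sym (lookup-flip-other Z i j j≢i)))

  SeparatedWithin : Subset n → Set
  SeparatedWithin D = ∀ {a b} → a ∈[ U , W ] → b ∈[ U , W ] → DifferWithin D a b → a ≢ b → Distinguished a b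

  face-vertex : ∀ {D a v} → D ⊆ W ─ U → a ∈[ U , W ] → DifferWithin D v a → v ∈[ U , W ]
  face-vertex D⊆ a∈ v∈ =
    DifferWithin⇒∈[] U⊆W (DifferWithin-trans (DifferWithin-mono D⊆ v∈) (∈[]⇒DifferWithin U⊆W a∈))

  facets-separating : ∀ {D a} → D ⊆ W ─ U → a ∈[ U , W ] → (∀ {D′} → D′ ⊂ D → SeparatedWithin D′) →
                      ∀ {l c} → l ∈ D → DifferWithin D c a → SeparatingOn (D - l) c
  facets-separating {D} D⊆ a∈ below {l} {c} l∈D c∈ p∈ q∈ =
    below (x∈p⇒p-x⊂p l∈D) (vertex p∈) (vertex q∈) (DifferWithin-trans p∈ (DifferWithin-sym q∈))
    where
    vertex : ∀ {v} → DifferWithin (D - l) v c → v ∈[ U , W ]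
    vertex v∈ = face-vertex D⊆ a∈ (DifferWithin-trans (DifferWithin-mono (p─q⊆p D ⁅ l ⁆) v∈) c∈)

  twin-impossible : PropertyL O → ∀ {D Z w} → D ⊆ W ─ U → (∀ {D′} → D′ ⊂ D → SeparatedWithin D′) →
                    Z ∈[ U , W ] → Z ⊆ w → DifferWithin D w Z → w ≢ Z → Realises D (out Z) w → ⊥
  twin-impossible acyclic {D} {Z} {w} D⊆ below Z∈ Z⊆w w∈ w≢Z r =
    let i , cycle = L-cycle Z∈ (proj₂ w-vertex) Z⊆w (≢-sym w≢Z) (λ i∈ → sym (r _ (in-D i∈))) distinguished
    in acyclic Z Z∈ i cycle
    where
    w-vertex = face-vertex D⊆ Z∈ w∈
    in-D : ∀ {i} → i ∈ w ─ Z → i ∈ D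
    in-D i∈ = DifferWithin-∈ w∈ (∈─⇒lookup≢ i∈)
    distinguished : ∀ {i} → i ∈ w ─ Z → Distinguished w (Z ⊕ ⁅ i ⁆)
    distinguished {i} i∈ =
      below (x∈p⇒p-x⊂p i∈D) w-vertex (face-vertex D⊆ Z∈ (DifferWithin-flip i∈D))
            (DifferWithin-agree (DifferWithin-trans w∈ (DifferWithin-sym (DifferWithin-flip i∈D)))
                                (∈─⇒lookup≡flip i∈))
            w≢Z⊕i
      where
      i∈D = in-D i∈
      w≢Z⊕i : w ≢ Z ⊕ ⁅ i ⁆
      w≢Z⊕i refl = not-¬ refl (trans (sym (r i i∈D)) (out-flip Z∈ (D⊆ i∈D)))

  collision-impossible : PropertyL O → ∀ {D a b} → D ⊆ W ─ U → (∀ {D′} → D′ ⊂ D → SeparatedWithin D′) →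
                         a ∈[ U , W ] → DifferWithin D b a → a ≢ b → Realises D (out a) b → ⊥
  collision-impossible acyclic {D} {a} D⊆ below a∈ b∈ a≢b r =
    let k , ak≢bk = ≢⇒lookup≢ a≢b
        open Collisions (DifferWithin-∈ (DifferWithin-sym b∈) ak≢bk) (facets-separating D⊆ a∈ below)
        w , w∈ , w≢a─D , rw = bottom-twin (pair-collision b∈ ak≢bk r)
    in twin-impossible acyclic D⊆ below (face-vertex D⊆ a∈ DifferWithin-─) (DifferWithin-─⇒⊆ w∈) w∈ w≢a─D rw

  separated : PropertyL O → ∀ {D} → Acc _⊂_ D → D ⊆ W ─ U → SeparatedWithin D
  separated acyclic {D} (acc rec) D⊆ {a} {b} a∈ b∈ ab a≢b
    with any? (λ l → l ∈? D ×-dec lookup a l ≟ᵇ lookup b l)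
  ... | yes (l , l∈D , al≡bl) =
    separated acyclic (rec (x∈p⇒p-x⊂p l∈D)) (⊆-trans (p─q⊆p D ⁅ l ⁆) D⊆) a∈ b∈
              (DifferWithin-agree ab al≡bl) a≢b
  ... | no nowhere-equal with any? (λ i → ¬? (lookup a i ≟ᵇ lookup b i) ×-dec ¬? (out a i ≟ᵇ out b i))
  ...   | yes distinguished = distinguished
  ...   | no indistinguished =
    ⊥-elim (collision-impossible acyclic D⊆ below a∈ (DifferWithin-sym ab) a≢b realises)
    where
    below : ∀ {D′} → D′ ⊂ D → SeparatedWithin D′
    below D′⊂D = separated acyclic (rec D′⊂D) (⊆-trans (p⊂q⇒p⊆q D′⊂D) D⊆)
    realises : Realises D (out a) b
    realises i i∈D = decidable-stable (out b i ≟ᵇ out a i)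
      λ ne → indistinguished (i , (λ eq → nowhere-equal (i , i∈D , eq)) , ne ∘ sym)

  cube-separating : PropertyL O → SeparatingOn (W ─ U) U
  cube-separating acyclic a∈ b∈ =
    separated acyclic (⊂-wellFounded _) id (DifferWithin⇒∈[] U⊆W a∈) (DifferWithin⇒∈[] U⊆W b∈)
              (DifferWithin-trans a∈ (DifferWithin-sym b∈))

  module _ {A B : Subset n} (A⊆B : A ⊆ B) where

    sink⇒out≡false : ∀ {X} → IsSinkIn O A B X → Realises (B ─ A) (const false) X
    sink⇒out≡false (X∈ , no-edge) i i∈ = ¬-not λ out≡true →
      no-edge _ (DifferWithin⇒∈[] A⊆B (DifferWithin-trans (DifferWithin-flip i∈) (∈[]⇒DifferWithin A⊆B X∈)))
              (out≡true⇒Edge out≡true)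

    out≡false⇒sink : ∀ {X} → X ∈[ A , B ] → Realises (B ─ A) (const false) X → IsSinkIn O A B X
    out≡false⇒sink {X} X∈ r = X∈ , no-edge
      where
      no-edge : ∀ Y → Y ∈[ A , B ] → ¬ Edge X Y
      no-edge Y Y∈ e with edge-ok e
      ... | _ , _ , i , _ , refl = not-¬ (Edge⇒out≡true e) (r i i∈B─A)
        where
        i∈B─A = DifferWithin-∈ (DifferWithin-trans (∈[]⇒DifferWithin A⊆B X∈)
                                                   (DifferWithin-sym (∈[]⇒DifferWithin A⊆B Y∈)))
                               (lookup-flip-≢ X i)

theorem1 : ∀ {n : ℕ} (O : CubeOrientation n) → PropertyL O → IsUSO O
theorem1 O acyclic A B U⊆A A⊆B B⊆W =
  let X , X∈ , X-out = realise separating (const false)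
  in X , out≡false⇒sink O A⊆B (DifferWithin⇒∈[] A⊆B X∈) X-out ,
     λ Y Y-sink → realise-unique separating (∈[]⇒DifferWithin A⊆B (proj₁ Y-sink)) X∈
                    λ i i∈ → trans (sink⇒out≡false O A⊆B Y-sink i i∈) (sym (X-out i i∈))
  where
  open CubeOrientation O
  open Outmap (out O)
  separating : SeparatingOn (B ─ A) A
  separating = SeparatingOn-mono (─-mono B⊆W U⊆A) (∈[]⇒DifferWithin U⊆W (U⊆A , B⊆W ∘ A⊆B))
                                 (cube-separating O acyclic)
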